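{- Let $m$ be an odd positive integer and $r$ an even positive integer, and let $n$ be a positive integer. Then there exists a shiftable $SMR(m,n;r,2)$ if and only if $m\geq 3$, $r\geq 4$ and $mr=2n$.
   Context: A signed magic rectangle $SMR(m,n;r,s)$ is an $m\times n$ array, some of whose cells are filled with integers and the others empty, such that exactly $r$ cells in every row and exactly $s$ cells in every column are filled (so $mr=ns$), every element of $X$ appears exactly once in the array, and the sum of the entries of each row and of each column is zero, where (for $mr$ even) $X=\{\pm1,\pm2,\ldots,\pm mr/2\}$. An array is shiftable if every row and every column contains the same number of positive entries as negative entries. -}

module Defs where

open import Data.Nat using (ℕ; zero; suc; _*_; _≤_; _<_)
open import Data.Nat.DivMod using (_/_)
open import Data.Integer as ℤ using (ℤ; +_; -_; ∣_∣)
open import Data.Integer.Properties as ℤP using ()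
open import Data.Fin using (Fin; zero; suc)
open import Data.Maybe using (Maybe; just; nothing)
open import Data.Maybe.Properties using (≡-dec)
open import Data.Bool using (Bool; true; false)
open import Data.Product using (_×_; ∃)
open import Relation.Nullary using (¬_)
open import Relation.Nullary.Decidable using (⌊_⌋)
open import Relation.Binary.PropositionalEquality using (_≡_)

count : ∀ {k} → (Fin k → Bool) → ℕ
count {zero}  p = 0
count {suc k} p = (if p zero then 1 else 0) Data.Nat.+ count (λ i → p (suc i))
  where open import Data.Bool using (if_then_else_)

sumℕ : ∀ {k} → (Fin k → ℕ) → ℕ
sumℕ {zero}  f = 0
sumℕ {suc k} f = f zero Data.Nat.+ sumℕ (λ i → f (suc i))

sumℤ : ∀ {k} → (Fin k → ℤ) → ℤ
sumℤ {zero}  f = + 0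
sumℤ {suc k} f = f zero ℤ.+ sumℤ (λ i → f (suc i))

Array : ℕ → ℕ → Set
Array m n = Fin m → Fin n → Maybe ℤ

filled : Maybe ℤ → Bool
filled (just _) = true
filled nothing  = false

val : Maybe ℤ → ℤ
val (just x) = x
val nothing  = + 0

isPos : Maybe ℤ → Bool
isPos c = filled c Data.Bool.∧ ⌊ + 1 ℤ.≤? val c ⌋

isNeg : Maybe ℤ → Bool
isNeg c = filled c Data.Bool.∧ ⌊ val c ℤ.≤? - (+ 1) ⌋

isVal : ℤ → Maybe ℤ → Bool
isVal x c = ⌊ ≡-dec ℤP._≟_ c (just x) ⌋

InX : ℕ → ℤ → Set
InX h x = ¬ (x ≡ + 0) × ∣ x ∣ ≤ h

record IsSMR (m n r s : ℕ) (A : Array m n) : Set where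
  field
    size-eq    : m * r ≡ n * s
    row-filled : ∀ i → count (λ j → filled (A i j)) ≡ r
    col-filled : ∀ j → count (λ i → filled (A i j)) ≡ s
    entries-in-X : ∀ i j x → A i j ≡ just x → InX ((m * r) / 2) x
    each-once  : ∀ x → InX ((m * r) / 2) x →
                 sumℕ (λ i → count (λ j → isVal x (A i j))) ≡ 1
    row-sum    : ∀ i → sumℤ (λ j → val (A i j)) ≡ + 0
    col-sum    : ∀ j → sumℤ (λ i → val (A i j)) ≡ + 0

record Shiftable {m n : ℕ} (A : Array m n) : Set where
  field
    row-bal : ∀ i → count (λ j → isPos (A i j)) ≡ count (λ j → isNeg (A i j))
    col-bal : ∀ j → count (λ i → isPos (A i j)) ≡ count (λ i → isNeg (A i j))

-- A shiftable SMR(m,n;2k,2) is built from a directed multigraph on the m rows with n edges: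
-- edge j becomes column j, with +(j+1) in the row of its source and −(j+1) in the row of its
-- target. Shiftability then asks every vertex to have in- and out-degree k, and zero row sums
-- ask the labels leaving each vertex to add up to those entering it. Such balanced loopless
-- graphs exist on 2 and 3 vertices with k = 2 and on 3, 4 and 5 vertices with k = 3, and they
-- are closed under disjoint union (same k) and under overlay on a common vertex set (the k add:
-- listing the second graph's edges after the first's raises the in- and out-weight of each
-- vertex by the same amount, its in- and out-degrees being equal). Conversely, a column has two
-- filled cells, so the odd m is at least 3; and r = 2 is impossible: a row is then +t, −t, the
-- column through its +t also holds −t, so −t occurs twice.
module Submission where

open import Defs
open import Data.Bool using (Bool; true; false; if_then_else_; _∨_)
open import Data.Bool.Properties using (¬-not)
open import Data.Empty using (⊥-elim)
open import Data.Fin as Fin using (Fin; zero; suc; toℕ; _↑ˡ_; _↑ʳ_; splitAt; join; _≟_; #_)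
import Data.Fin.Properties as Finₚ
open import Data.Integer using (ℤ; +_; +[1+_]; -[1+_]; _-_) renaming (_+_ to _+ℤ_)
import Data.Integer.Properties as ℤₚ
import Data.Integer.Tactic.RingSolver as ℤ-Solver
open import Data.Maybe using (Maybe; just; nothing)
open import Data.Maybe.Properties using (≡-dec; just-injective)
import Data.Nat as ℕ
open import Data.Nat using (ℕ; zero; suc; _+_; _*_; _≤_; _<_; z≤n; s≤s)
open import Data.Nat.DivMod using (_/_; m*n/n≡m)
open import Data.Nat.Properties hiding (_≟_)
open import Data.Nat.Tactic.RingSolver using (solve-∀)
open import Data.Product using (_×_; _,_; ∃; Σ; proj₁; proj₂)
open import Data.Sum using (_⊎_; inj₁; inj₂; [_,_])
open import Data.Vec as Vec using (Vec; []; _∷_)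
open import Data.Vec.Functional using (_++_)
open import Data.Vec.Functional.Properties using (lookup-++ˡ; lookup-++ʳ)
open import Function using (_∘_; case_of_)
open import Function.Bundles using (_⇔_; mk⇔)
open import Function.Definitions using (Injective)
open import Relation.Binary.PropositionalEquality
open import Relation.Nullary using (¬_; does; yes; no; Dec; ¬?; _×-dec_)
open import Relation.Nullary.Decidable using (dec-true; dec-false; True; toWitness)

private variable k k₁ k₂ m m₁ m₂ n n₁ n₂ : ℕ

-- Sums and counts over Fin

sumWhere : (Fin k → Bool) → (Fin k → ℕ) → ℕ
sumWhere p w = sumℕ (λ j → if p j then w j else 0)

count≡sumWhere : (p : Fin k → Bool) → count p ≡ sumWhere p (λ _ → 1)
count≡sumWhere {zero}  p = refl
count≡sumWhere {suc k} p = cong (_+_ (if p zero then 1 else 0)) (count≡sumWhere (p ∘ suc))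

sumℕ-cong : {f g : Fin k → ℕ} → (∀ j → f j ≡ g j) → sumℕ f ≡ sumℕ g
sumℕ-cong {zero}  f≗g = refl
sumℕ-cong {suc k} f≗g = cong₂ _+_ (f≗g zero) (sumℕ-cong (f≗g ∘ suc))

sumℤ-cong : {f g : Fin k → ℤ} → (∀ j → f j ≡ g j) → sumℤ f ≡ sumℤ g
sumℤ-cong {zero}  f≗g = refl
sumℤ-cong {suc k} f≗g = cong₂ _+ℤ_ (f≗g zero) (sumℤ-cong (f≗g ∘ suc))

sumWhere-cong : {p q : Fin k → Bool} {v w : Fin k → ℕ} →
                (∀ j → p j ≡ q j) → (∀ j → v j ≡ w j) → sumWhere p v ≡ sumWhere q w
sumWhere-cong p≗q v≗w = sumℕ-cong (λ j → cong₂ (λ b x → if b then x else 0) (p≗q j) (v≗w j))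

count-cong : {p q : Fin k → Bool} → (∀ j → p j ≡ q j) → count p ≡ count q
count-cong {p = p} {q} p≗q = begin
  count p               ≡⟨ count≡sumWhere p ⟩
  sumWhere p (λ _ → 1)  ≡⟨ sumWhere-cong p≗q (λ _ → refl) ⟩
  sumWhere q (λ _ → 1)  ≡⟨ count≡sumWhere q ⟨
  count q               ∎
  where open ≡-Reasoning

sumℕ-zero : (f : Fin k → ℕ) → (∀ j → f j ≡ 0) → sumℕ f ≡ 0
sumℕ-zero {zero}  f f≡0 = refl
sumℕ-zero {suc k} f f≡0 = cong₂ _+_ (f≡0 zero) (sumℕ-zero (f ∘ suc) (f≡0 ∘ suc))

sumℕ-single : (f : Fin k → ℕ) (j₀ : Fin k) → (∀ j → j ≢ j₀ → f j ≡ 0) → sumℕ f ≡ f j₀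
sumℕ-single f zero f≡0 =
  trans (cong (_+_ (f zero)) (sumℕ-zero (f ∘ suc) (λ j → f≡0 (suc j) λ ()))) (+-identityʳ (f zero))
sumℕ-single f (suc j₀) f≡0 = cong₂ _+_ (f≡0 zero λ ())
  (sumℕ-single (f ∘ suc) j₀ (λ j j≢j₀ → f≡0 (suc j) (j≢j₀ ∘ Finₚ.suc-injective)))

sumWhere-none : (p : Fin k → Bool) (w : Fin k → ℕ) → (∀ j → p j ≡ false) → sumWhere p w ≡ 0
sumWhere-none p w p≡false = sumℕ-zero _ (λ j → cong (λ b → if b then w j else 0) (p≡false j))

count-none : (p : Fin k → Bool) → (∀ j → p j ≡ false) → count p ≡ 0
count-none p p≡false = trans (count≡sumWhere p) (sumWhere-none p _ p≡false)

count-single : (p : Fin k → Bool) (j₀ : Fin k) → (∀ j → j ≢ j₀ → p j ≡ false) → p j₀ ≡ true →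
               count p ≡ 1
count-single p j₀ p≡false pj₀ = begin
  count p                  ≡⟨ count≡sumWhere p ⟩
  sumWhere p (λ _ → 1)     ≡⟨ sumℕ-single _ j₀ (λ j j≢j₀ → cong (λ b → if b then 1 else 0) (p≡false j j≢j₀)) ⟩
  (if p j₀ then 1 else 0)  ≡⟨ cong (λ b → if b then 1 else 0) pj₀ ⟩
  1                        ∎
  where open ≡-Reasoning

sumWhere-≟ : (a : Fin k) (w : Fin k → ℕ) → sumWhere (λ i → does (a ≟ i)) w ≡ w a
sumWhere-≟ a w = trans
  (sumℕ-single _ a (λ i i≢a → cong (λ b → if b then w i else 0) (dec-false (a ≟ i) (i≢a ∘ sym))))
  (cong (λ b → if b then w a else 0) (dec-true (a ≟ a) refl))

count-≟ : (a : Fin k) → count (λ i → does (a ≟ i)) ≡ 1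
count-≟ a = trans (count≡sumWhere (λ i → does (a ≟ i))) (sumWhere-≟ a (λ _ → 1))

sumℕ-↑ : ∀ n₁ (f : Fin (n₁ + n₂) → ℕ) → sumℕ f ≡ sumℕ (f ∘ (_↑ˡ n₂)) + sumℕ (f ∘ (n₁ ↑ʳ_))
sumℕ-↑ zero     f = refl
sumℕ-↑ (suc n₁) f = trans (cong (_+_ (f zero)) (sumℕ-↑ n₁ (f ∘ suc))) (sym (+-assoc (f zero) _ _))

sumWhere-↑ : ∀ n₁ (p : Fin (n₁ + n₂) → Bool) (w : Fin (n₁ + n₂) → ℕ) →
             sumWhere p w ≡ sumWhere (p ∘ (_↑ˡ n₂)) (w ∘ (_↑ˡ n₂)) + sumWhere (p ∘ (n₁ ↑ʳ_)) (w ∘ (n₁ ↑ʳ_))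
sumWhere-↑ n₁ p w = sumℕ-↑ n₁ _

count-↑ : ∀ n₁ (p : Fin (n₁ + n₂) → Bool) → count p ≡ count (p ∘ (_↑ˡ n₂)) + count (p ∘ (n₁ ↑ʳ_))
count-↑ {n₂ = n₂} n₁ p = trans (count≡sumWhere p) (trans (sumWhere-↑ n₁ p _)
  (sym (cong₂ _+_ (count≡sumWhere (p ∘ (_↑ˡ n₂))) (count≡sumWhere (p ∘ (n₁ ↑ʳ_))))))

sumWhere-const+ : (p : Fin k → Bool) (c : ℕ) (w : Fin k → ℕ) →
                  sumWhere p (λ j → c + w j) ≡ c * count p + sumWhere p w
sumWhere-const+ {zero}  p c w = cong (_+ 0) (sym (*-zeroʳ c))
sumWhere-const+ {suc k} p c w with p zero
... | true  = trans (cong (_+_ (c + w zero)) (sumWhere-const+ (p ∘ suc) c (w ∘ suc))) (regroup c (w zero) _ _)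
  where
  regroup : ∀ c w x y → c + w + (c * x + y) ≡ c * (1 + x) + (w + y)
  regroup = solve-∀
... | false = sumWhere-const+ (p ∘ suc) c (w ∘ suc)

count-∨ : (p q : Fin k → Bool) → (∀ j → p j ≡ true → q j ≡ false) →
          count (λ j → p j ∨ q j) ≡ count p + count q
count-∨ {zero}  p q disjoint = refl
count-∨ {suc k} p q disjoint with p zero in p₀ | q zero in q₀ | count-∨ (p ∘ suc) (q ∘ suc) (disjoint ∘ suc)
... | true  | true  | _  = case trans (sym q₀) (disjoint zero p₀) of λ ()
... | true  | false | IH = cong suc IH
... | false | true  | IH = trans (cong suc IH) (sym (+-suc _ _))
... | false | false | IH = IH

count-≤ : (p : Fin k → Bool) → count p ≤ k
count-≤ {zero}  p = z≤n
count-≤ {suc k} p with p zero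
... | true  = s≤s (count-≤ (p ∘ suc))
... | false = m≤n⇒m≤1+n (count-≤ (p ∘ suc))

sumℕ-≥ : (f : Fin k → ℕ) (j : Fin k) → f j ≤ sumℕ f
sumℕ-≥ f zero    = m≤m+n (f zero) _
sumℕ-≥ f (suc j) = ≤-trans (sumℕ-≥ (f ∘ suc) j) (m≤n+m _ (f zero))

sumℕ-≥-pair : (f : Fin k → ℕ) {a b : Fin k} → a ≢ b → f a + f b ≤ sumℕ f
sumℕ-≥-pair f {zero}  {zero}  a≢b = ⊥-elim (a≢b refl)
sumℕ-≥-pair f {zero}  {suc b} _   = +-monoʳ-≤ (f zero) (sumℕ-≥ (f ∘ suc) b)
sumℕ-≥-pair f {suc a} {zero}  _   =
  ≤-trans (≤-reflexive (+-comm (f (suc a)) (f zero))) (+-monoʳ-≤ (f zero) (sumℕ-≥ (f ∘ suc) a))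
sumℕ-≥-pair f {suc a} {suc b} a≢b = ≤-trans (sumℕ-≥-pair (f ∘ suc) (a≢b ∘ cong suc)) (m≤n+m _ (f zero))

count-≥1 : (p : Fin k → Bool) {j : Fin k} → p j ≡ true → 1 ≤ count p
count-≥1 p {j} pj = begin
  1                       ≡⟨ cong (λ b → if b then 1 else 0) pj ⟨
  (if p j then 1 else 0)  ≤⟨ sumℕ-≥ _ j ⟩
  sumWhere p (λ _ → 1)    ≡⟨ count≡sumWhere p ⟨
  count p                 ∎
  where open ≤-Reasoning

count≡0⇒false : (p : Fin k → Bool) → count p ≡ 0 → ∀ j → p j ≡ false
count≡0⇒false p count≡0 j = ¬-not (λ pj → case ≤-trans (count-≥1 p pj) (≤-reflexive count≡0) of λ ())

count≡1⇒unique : (p : Fin k → Bool) → count p ≡ 1 →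
                 ∃ λ j → p j ≡ true × (∀ j′ → p j′ ≡ true → j′ ≡ j)
count≡1⇒unique {suc k} p count≡1 with p zero in p₀
... | true  = zero , p₀ , only
  where
  only : ∀ j′ → p j′ ≡ true → j′ ≡ zero
  only zero    _  = refl
  only (suc j) pj = case trans (sym pj) (count≡0⇒false (p ∘ suc) (suc-injective count≡1) j) of λ ()
... | false with count≡1⇒unique (p ∘ suc) count≡1
... | j , pj , only = suc j , pj , λ where
  zero     pz  → case trans (sym pz) p₀ of λ ()
  (suc j′) pj′ → cong suc (only j′ pj′)

sumℕ-count-unique : (P : Fin m → Fin n → Bool) (i₀ : Fin m) (j₀ : Fin n) →
                    (∀ i j → P i j ≡ true → i ≡ i₀ × j ≡ j₀) → P i₀ j₀ ≡ true →
                    sumℕ (λ i → count (P i)) ≡ 1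
sumℕ-count-unique P i₀ j₀ only Pi₀j₀ = begin
  sumℕ (λ i → count (P i))
    ≡⟨ sumℕ-single _ i₀ (λ i i≢i₀ → count-none (P i) (λ j → ¬-not (i≢i₀ ∘ proj₁ ∘ only i j))) ⟩
  count (P i₀)
    ≡⟨ count-single (P i₀) j₀ (λ j j≢j₀ → ¬-not (j≢j₀ ∘ proj₂ ∘ only i₀ j)) Pi₀j₀ ⟩
  1 ∎
  where open ≡-Reasoning

sumℤ-zero : (f : Fin k → ℤ) → (∀ j → f j ≡ + 0) → sumℤ f ≡ + 0
sumℤ-zero {zero}  f f≡0 = refl
sumℤ-zero {suc k} f f≡0 = cong₂ _+ℤ_ (f≡0 zero) (sumℤ-zero (f ∘ suc) (f≡0 ∘ suc))

sumℤ-single : (f : Fin k → ℤ) (j₀ : Fin k) → (∀ j → j ≢ j₀ → f j ≡ + 0) → sumℤ f ≡ f j₀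
sumℤ-single f zero f≡0 =
  trans (cong (_+ℤ_ (f zero)) (sumℤ-zero (f ∘ suc) (λ j → f≡0 (suc j) λ ()))) (ℤₚ.+-identityʳ (f zero))
sumℤ-single f (suc j₀) f≡0 = trans
  (cong₂ _+ℤ_ (f≡0 zero λ ()) (sumℤ-single (f ∘ suc) j₀ (λ j j≢j₀ → f≡0 (suc j) (j≢j₀ ∘ Finₚ.suc-injective))))
  (ℤₚ.+-identityˡ (f (suc j₀)))

sumℤ-pair : (f : Fin k → ℤ) {a b : Fin k} → a ≢ b → (∀ j → j ≢ a → j ≢ b → f j ≡ + 0) →
            sumℤ f ≡ f a +ℤ f b
sumℤ-pair f {zero}  {zero}  a≢b _    = ⊥-elim (a≢b refl)
sumℤ-pair f {zero}  {suc b} _   rest = cong (_+ℤ_ (f zero))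
  (sumℤ-single (f ∘ suc) b (λ j j≢b → rest (suc j) (λ ()) (j≢b ∘ Finₚ.suc-injective)))
sumℤ-pair f {suc a} {zero}  _   rest = trans
  (cong (_+ℤ_ (f zero)) (sumℤ-single (f ∘ suc) a (λ j j≢a → rest (suc j) (j≢a ∘ Finₚ.suc-injective) (λ ()))))
  (ℤₚ.+-comm (f zero) (f (suc a)))
sumℤ-pair f {suc a} {suc b} a≢b rest = begin
  f zero +ℤ sumℤ (f ∘ suc)    ≡⟨ cong (_+ℤ sumℤ (f ∘ suc)) (rest zero (λ ()) (λ ())) ⟩
  + 0 +ℤ sumℤ (f ∘ suc)       ≡⟨ ℤₚ.+-identityˡ (sumℤ (f ∘ suc)) ⟩
  sumℤ (f ∘ suc)              ≡⟨ sumℤ-pair (f ∘ suc) (a≢b ∘ cong suc) (λ j j≢a j≢b →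
                                   rest (suc j) (j≢a ∘ Finₚ.suc-injective) (j≢b ∘ Finₚ.suc-injective)) ⟩
  f (suc a) +ℤ f (suc b)      ∎
  where open ≡-Reasoning

sumℤ-pos : (f : Fin k → ℕ) → sumℤ (λ j → + f j) ≡ + sumℕ f
sumℤ-pos {zero}  f = refl
sumℤ-pos {suc k} f = cong (_+ℤ_ (+ f zero)) (sumℤ-pos (f ∘ suc))

sumℤ-distrib-minus : (f g : Fin k → ℤ) → sumℤ (λ j → f j - g j) ≡ sumℤ f - sumℤ g
sumℤ-distrib-minus {zero}  f g = refl
sumℤ-distrib-minus {suc k} f g = trans
  (cong (_+ℤ_ (f zero - g zero)) (sumℤ-distrib-minus (f ∘ suc) (g ∘ suc)))
  (interchange (f zero) (g zero) (sumℤ (f ∘ suc)) (sumℤ (g ∘ suc)))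
  where
  interchange : ∀ a b c d → a - b +ℤ (c - d) ≡ a +ℤ c - (b +ℤ d)
  interchange = ℤ-Solver.solve-∀

sumℤ-ℕ-difference : (f g : Fin k → ℕ) → sumℤ (λ j → + f j - + g j) ≡ + sumℕ f - + sumℕ g
sumℤ-ℕ-difference f g =
  trans (sumℤ-distrib-minus (λ j → + f j) (λ j → + g j)) (cong₂ _-_ (sumℤ-pos f) (sumℤ-pos g))

↑-elim : {P : Fin (m₁ + m₂) → Set} → (∀ x → P (x ↑ˡ m₂)) → (∀ y → P (m₁ ↑ʳ y)) → ∀ i → P i
↑-elim {m₁ = m₁} {m₂ = m₂} {P} onLeft onRight i =
  subst P (Finₚ.join-splitAt m₁ m₂ i) ([_,_] {C = P ∘ join m₁ m₂} onLeft onRight (splitAt m₁ i))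

↑ˡ≢↑ʳ : (x : Fin m₁) (y : Fin m₂) → x ↑ˡ m₂ ≢ m₁ ↑ʳ y
↑ˡ≢↑ʳ {m₁ = m₁} {m₂ = m₂} x y eq =
  case trans (sym (Finₚ.splitAt-↑ˡ m₁ x m₂)) (trans (cong (splitAt m₁) eq) (Finₚ.splitAt-↑ʳ m₁ m₂ y)) of λ ()

++-pointwise : ∀ {A B : Set} (R : A → B → Set) {f : Fin n₁ → A} {f′ : Fin n₂ → A} {g : Fin n₁ → B}
               {g′ : Fin n₂ → B} → (∀ j → R (f j) (g j)) → (∀ j → R (f′ j) (g′ j)) →
               ∀ j → R ((f ++ f′) j) ((g ++ g′) j)
++-pointwise {n₁ = n₁} R r r′ j with splitAt n₁ j
... | inj₁ x = r x
... | inj₂ y = r′ y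

-- Graphs with labelled edges

record Graph (m n : ℕ) : Set where
  field
    src tgt : Fin n → Fin m

open Graph

label : Fin n → ℕ
label j = suc (toℕ j)

incident : (Fin n → Fin m) → Fin m → Fin n → Bool
incident f i j = does (f j ≟ i)

degree : (Fin n → Fin m) → Fin m → ℕ
degree f i = count (incident f i)

labelAt : (Fin n → Fin m) → Fin m → Fin n → ℕ
labelAt f i j = if incident f i j then label j else 0

weight : (Fin n → Fin m) → Fin m → ℕ
weight f i = sumℕ (labelAt f i)

BalancedAt : ℕ → Graph m n → Fin m → Set
BalancedAt k G i = degree (src G) i ≡ k × degree (tgt G) i ≡ k × weight (src G) i ≡ weight (tgt G) i

IsBalanced : ℕ → Graph m n → Set
IsBalanced k G = ∀ i → BalancedAt k G i

Loopless : Graph m n → Set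
Loopless G = ∀ j → src G j ≢ tgt G j

degree-++ : (f : Fin n₁ → Fin m) (g : Fin n₂ → Fin m) (i : Fin m) →
            degree (f ++ g) i ≡ degree f i + degree g i
degree-++ {n₁ = n₁} f g i = trans (count-↑ n₁ (incident (f ++ g) i))
  (cong₂ _+_ (count-cong (λ j → cong (does ∘ (_≟ i)) (lookup-++ˡ f g j)))
             (count-cong (λ j → cong (does ∘ (_≟ i)) (lookup-++ʳ f g j))))

weight-++ : (f : Fin n₁ → Fin m) (g : Fin n₂ → Fin m) (i : Fin m) →
            weight (f ++ g) i ≡ weight f i + (n₁ * degree g i + weight g i)
weight-++ {n₁ = n₁} {n₂ = n₂} f g i = begin
  weight (f ++ g) i
    ≡⟨ sumWhere-↑ n₁ (incident (f ++ g) i) label ⟩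
  sumWhere (incident (f ++ g) i ∘ (_↑ˡ n₂)) (label ∘ (_↑ˡ n₂)) +
  sumWhere (incident (f ++ g) i ∘ (n₁ ↑ʳ_)) (label ∘ (n₁ ↑ʳ_))
    ≡⟨ cong₂ _+_
         (sumWhere-cong (λ j → cong (does ∘ (_≟ i)) (lookup-++ˡ f g j)) (λ j → cong suc (Finₚ.toℕ-↑ˡ j n₂)))
         (sumWhere-cong (λ j → cong (does ∘ (_≟ i)) (lookup-++ʳ f g j)) (λ j → cong suc (Finₚ.toℕ-↑ʳ n₁ j))) ⟩
  weight f i + sumWhere (incident g i) (λ j → suc (n₁ + toℕ j))
    ≡⟨ cong (_+_ (weight f i)) (sumWhere-cong {p = incident g i} (λ _ → refl) (λ j → sym (+-suc n₁ (toℕ j)))) ⟩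
  weight f i + sumWhere (incident g i) (λ j → n₁ + label j)
    ≡⟨ cong (_+_ (weight f i)) (sumWhere-const+ (incident g i) n₁ label) ⟩
  weight f i + (n₁ * degree g i + weight g i)
    ∎
  where open ≡-Reasoning

incident-∘-injective : {φ : Fin m₁ → Fin m₂} → Injective _≡_ _≡_ φ →
                       (f : Fin n → Fin m₁) (i : Fin m₁) (j : Fin n) → incident (φ ∘ f) (φ i) j ≡ incident f i j
incident-∘-injective {φ = φ} φ-injective f i j with f j ≟ i
... | yes fj≡i = dec-true (φ (f j) ≟ φ i) (cong φ fj≡i)
... | no  fj≢i = dec-false (φ (f j) ≟ φ i) (fj≢i ∘ φ-injective)

incident-∘-outside : {φ : Fin m₁ → Fin m₂} {i : Fin m₂} → (∀ x → φ x ≢ i) →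
                     (f : Fin n → Fin m₁) (j : Fin n) → incident (φ ∘ f) i j ≡ false
incident-∘-outside {φ = φ} {i} outside f j = dec-false (φ (f j) ≟ i) (outside (f j))

_⊕_ : (Fin n₁ → Fin m₁) → (Fin n₂ → Fin m₂) → Fin (n₁ + n₂) → Fin (m₁ + m₂)
_⊕_ {m₁ = m₁} {m₂ = m₂} f g = ((_↑ˡ m₂) ∘ f) ++ ((m₁ ↑ʳ_) ∘ g)

module _ (f : Fin n₁ → Fin m₁) (g : Fin n₂ → Fin m₂) where

  private
    left : Fin n₁ → Fin (m₁ + m₂)
    left = (_↑ˡ m₂) ∘ f

    right : Fin n₂ → Fin (m₁ + m₂)
    right = (m₁ ↑ʳ_) ∘ g

    left-at-left : (x : Fin m₁) (j : Fin n₁) → incident left (x ↑ˡ m₂) j ≡ incident f x j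
    left-at-left = incident-∘-injective (Finₚ.↑ˡ-injective m₂ _ _) f

    right-at-left : (x : Fin m₁) (j : Fin n₂) → incident right (x ↑ˡ m₂) j ≡ false
    right-at-left x = incident-∘-outside (λ y → ↑ˡ≢↑ʳ x y ∘ sym) g

    left-at-right : (y : Fin m₂) (j : Fin n₁) → incident left (m₁ ↑ʳ y) j ≡ false
    left-at-right y = incident-∘-outside (λ x → ↑ˡ≢↑ʳ x y) f

    right-at-right : (y : Fin m₂) (j : Fin n₂) → incident right (m₁ ↑ʳ y) j ≡ incident g y j
    right-at-right = incident-∘-injective (Finₚ.↑ʳ-injective m₁ _ _) g

  degree-⊕ˡ : (x : Fin m₁) → degree (f ⊕ g) (x ↑ˡ m₂) ≡ degree f x
  degree-⊕ˡ x = begin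
    degree (f ⊕ g) (x ↑ˡ m₂)                        ≡⟨ degree-++ left right (x ↑ˡ m₂) ⟩
    degree left (x ↑ˡ m₂) + degree right (x ↑ˡ m₂)  ≡⟨ cong₂ _+_ (count-cong (left-at-left x))
                                                                  (count-none _ (right-at-left x)) ⟩
    degree f x + 0                                  ≡⟨ +-identityʳ _ ⟩
    degree f x                                      ∎
    where open ≡-Reasoning

  weight-⊕ˡ : (x : Fin m₁) → weight (f ⊕ g) (x ↑ˡ m₂) ≡ weight f x
  weight-⊕ˡ x = begin
    weight (f ⊕ g) (x ↑ˡ m₂)
      ≡⟨ weight-++ left right (x ↑ˡ m₂) ⟩
    weight left (x ↑ˡ m₂) + (n₁ * degree right (x ↑ˡ m₂) + weight right (x ↑ˡ m₂))
      ≡⟨ cong₂ (λ a b → a + (n₁ * b + weight right (x ↑ˡ m₂)))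
               (sumWhere-cong (left-at-left x) (λ _ → refl)) (count-none _ (right-at-left x)) ⟩
    weight f x + (n₁ * 0 + weight right (x ↑ˡ m₂))
      ≡⟨ cong₂ (λ a b → weight f x + (a + b)) (*-zeroʳ n₁) (sumWhere-none _ label (right-at-left x)) ⟩
    weight f x + 0
      ≡⟨ +-identityʳ _ ⟩
    weight f x
      ∎
    where open ≡-Reasoning

  degree-⊕ʳ : (y : Fin m₂) → degree (f ⊕ g) (m₁ ↑ʳ y) ≡ degree g y
  degree-⊕ʳ y = begin
    degree (f ⊕ g) (m₁ ↑ʳ y)                        ≡⟨ degree-++ left right (m₁ ↑ʳ y) ⟩
    degree left (m₁ ↑ʳ y) + degree right (m₁ ↑ʳ y)  ≡⟨ cong₂ _+_ (count-none _ (left-at-right y))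
                                                                  (count-cong (right-at-right y)) ⟩
    0 + degree g y                                  ∎
    where open ≡-Reasoning

  weight-⊕ʳ : (y : Fin m₂) → weight (f ⊕ g) (m₁ ↑ʳ y) ≡ n₁ * degree g y + weight g y
  weight-⊕ʳ y = begin
    weight (f ⊕ g) (m₁ ↑ʳ y)
      ≡⟨ weight-++ left right (m₁ ↑ʳ y) ⟩
    weight left (m₁ ↑ʳ y) + (n₁ * degree right (m₁ ↑ʳ y) + weight right (m₁ ↑ʳ y))
      ≡⟨ cong₂ (λ a b → a + (n₁ * b + weight right (m₁ ↑ʳ y)))
               (sumWhere-none _ label (left-at-right y)) (count-cong (right-at-right y)) ⟩
    0 + (n₁ * degree g y + weight right (m₁ ↑ʳ y))
      ≡⟨ cong (_+_ (n₁ * degree g y)) (sumWhere-cong (right-at-right y) (λ _ → refl)) ⟩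
    n₁ * degree g y + weight g y
      ∎
    where open ≡-Reasoning

overlay : Graph m n₁ → Graph m n₂ → Graph m (n₁ + n₂)
overlay G H = record { src = src G ++ src H ; tgt = tgt G ++ tgt H }

disjointUnion : Graph m₁ n₁ → Graph m₂ n₂ → Graph (m₁ + m₂) (n₁ + n₂)
disjointUnion G H = record { src = src G ⊕ src H ; tgt = tgt G ⊕ tgt H }

overlay-balanced : (G : Graph m n₁) (H : Graph m n₂) → IsBalanced k₁ G → IsBalanced k₂ H →
                   IsBalanced (k₁ + k₂) (overlay G H)
overlay-balanced {n₁ = n₁} G H balG balH i with balG i | balH i
... | outG , inG , wG | outH , inH , wH =
  trans (degree-++ (src G) (src H) i) (cong₂ _+_ outG outH) ,
  trans (degree-++ (tgt G) (tgt H) i) (cong₂ _+_ inG inH) ,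
  (begin
    weight (src G ++ src H) i
      ≡⟨ weight-++ (src G) (src H) i ⟩
    weight (src G) i + (n₁ * degree (src H) i + weight (src H) i)
      ≡⟨ cong₂ _+_ wG (cong₂ (λ d w → n₁ * d + w) (trans outH (sym inH)) wH) ⟩
    weight (tgt G) i + (n₁ * degree (tgt H) i + weight (tgt H) i)
      ≡⟨ weight-++ (tgt G) (tgt H) i ⟨
    weight (tgt G ++ tgt H) i
      ∎)
  where open ≡-Reasoning

disjointUnion-balanced : (G : Graph m₁ n₁) (H : Graph m₂ n₂) → IsBalanced k G → IsBalanced k H →
                         IsBalanced k (disjointUnion G H)
disjointUnion-balanced {m₁ = m₁} {n₁ = n₁} {m₂ = m₂} {k = k} G H balG balH = ↑-elim atLeft atRight
  where
  atLeft : ∀ x → BalancedAt k (disjointUnion G H) (x ↑ˡ m₂)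
  atLeft x with balG x
  ... | out , in′ , w =
    trans (degree-⊕ˡ (src G) (src H) x) out ,
    trans (degree-⊕ˡ (tgt G) (tgt H) x) in′ ,
    trans (weight-⊕ˡ (src G) (src H) x) (trans w (sym (weight-⊕ˡ (tgt G) (tgt H) x)))

  atRight : ∀ y → BalancedAt k (disjointUnion G H) (m₁ ↑ʳ y)
  atRight y with balH y
  ... | out , in′ , w =
    trans (degree-⊕ʳ (src G) (src H) y) out ,
    trans (degree-⊕ʳ (tgt G) (tgt H) y) in′ ,
    trans (weight-⊕ʳ (src G) (src H) y)
          (trans (cong₂ (λ d w → n₁ * d + w) (trans out (sym in′)) w) (sym (weight-⊕ʳ (tgt G) (tgt H) y)))

overlay-loopless : (G : Graph m n₁) (H : Graph m n₂) → Loopless G → Loopless H → Loopless (overlay G H)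
overlay-loopless G H = ++-pointwise _≢_

disjointUnion-loopless : (G : Graph m₁ n₁) (H : Graph m₂ n₂) → Loopless G → Loopless H →
                         Loopless (disjointUnion G H)
disjointUnion-loopless {m₁ = m₁} {m₂ = m₂} G H loopG loopH = ++-pointwise _≢_
  (λ j → loopG j ∘ Finₚ.↑ˡ-injective m₂ _ _) (λ j → loopH j ∘ Finₚ.↑ʳ-injective m₁ _ _)

-- Balanced graphs of every size

record BalancedGraph (m k : ℕ) : Set where
  field
    size     : ℕ
    size≡    : size ≡ m * k
    graph    : Graph m size
    balanced : IsBalanced k graph
    loopless : Loopless graph

overlayᴮ : BalancedGraph m k₁ → BalancedGraph m k₂ → BalancedGraph m (k₁ + k₂)
overlayᴮ {m = m} {k₁ = k₁} {k₂ = k₂} G H = record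
  { size     = G.size + H.size
  ; size≡    = trans (cong₂ _+_ G.size≡ H.size≡) (sym (*-distribˡ-+ m k₁ k₂))
  ; graph    = overlay G.graph H.graph
  ; balanced = overlay-balanced G.graph H.graph G.balanced H.balanced
  ; loopless = overlay-loopless G.graph H.graph G.loopless H.loopless
  }
  where
  module G = BalancedGraph G
  module H = BalancedGraph H

disjointUnionᴮ : BalancedGraph m₁ k → BalancedGraph m₂ k → BalancedGraph (m₁ + m₂) k
disjointUnionᴮ {m₁ = m₁} {k = k} {m₂ = m₂} G H = record
  { size     = G.size + H.size
  ; size≡    = trans (cong₂ _+_ G.size≡ H.size≡) (sym (*-distribʳ-+ k m₁ m₂))
  ; graph    = disjointUnion G.graph H.graph
  ; balanced = disjointUnion-balanced G.graph H.graph G.balanced H.balanced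
  ; loopless = disjointUnion-loopless G.graph H.graph G.loopless H.loopless
  }
  where
  module G = BalancedGraph G
  module H = BalancedGraph H

balanced? : ∀ k (G : Graph m n) → Dec (IsBalanced k G)
balanced? k G = Finₚ.all? λ i →
  (degree (src G) i ℕ.≟ k) ×-dec (degree (tgt G) i ℕ.≟ k) ×-dec (weight (src G) i ℕ.≟ weight (tgt G) i)

loopless? : (G : Graph m n) → Dec (Loopless G)
loopless? G = Finₚ.all? λ j → ¬? (src G j ≟ tgt G j)

graphOf : Vec (Fin m) n → Vec (Fin m) n → Graph m n
graphOf srcs tgts = record { src = Vec.lookup srcs ; tgt = Vec.lookup tgts }

checkedGraph : (srcs tgts : Vec (Fin m) (m * k)) →
               {True (balanced? k (graphOf srcs tgts))} → {True (loopless? (graphOf srcs tgts))} →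
               BalancedGraph m k
checkedGraph {m = m} {k = k} srcs tgts {bal} {loop} = record
  { size = m * k ; size≡ = refl ; graph = graphOf srcs tgts ; balanced = toWitness bal ; loopless = toWitness loop }

seed-2-2 : BalancedGraph 2 2
seed-2-2 = checkedGraph (# 1 ∷ # 0 ∷ # 0 ∷ # 1 ∷ [])
                        (# 0 ∷ # 1 ∷ # 1 ∷ # 0 ∷ [])

seed-3-2 : BalancedGraph 3 2
seed-3-2 = checkedGraph (# 2 ∷ # 1 ∷ # 1 ∷ # 0 ∷ # 0 ∷ # 2 ∷ [])
                        (# 1 ∷ # 2 ∷ # 0 ∷ # 1 ∷ # 2 ∷ # 0 ∷ [])

seed-3-3 : BalancedGraph 3 3
seed-3-3 = checkedGraph (# 0 ∷ # 1 ∷ # 2 ∷ # 2 ∷ # 0 ∷ # 1 ∷ # 1 ∷ # 2 ∷ # 0 ∷ [])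
                        (# 1 ∷ # 2 ∷ # 0 ∷ # 0 ∷ # 1 ∷ # 2 ∷ # 2 ∷ # 0 ∷ # 1 ∷ [])

seed-4-3 : BalancedGraph 4 3
seed-4-3 = checkedGraph (# 0 ∷ # 3 ∷ # 1 ∷ # 0 ∷ # 1 ∷ # 2 ∷ # 2 ∷ # 3 ∷ # 2 ∷ # 3 ∷ # 1 ∷ # 0 ∷ [])
                        (# 1 ∷ # 0 ∷ # 2 ∷ # 3 ∷ # 0 ∷ # 1 ∷ # 3 ∷ # 2 ∷ # 3 ∷ # 0 ∷ # 2 ∷ # 1 ∷ [])

seed-5-3 : BalancedGraph 5 3
seed-5-3 = checkedGraph
  (# 4 ∷ # 0 ∷ # 3 ∷ # 3 ∷ # 1 ∷ # 3 ∷ # 2 ∷ # 2 ∷ # 4 ∷ # 0 ∷ # 0 ∷ # 4 ∷ # 1 ∷ # 2 ∷ # 1 ∷ [])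
  (# 3 ∷ # 3 ∷ # 4 ∷ # 4 ∷ # 2 ∷ # 0 ∷ # 1 ∷ # 0 ∷ # 0 ∷ # 3 ∷ # 2 ∷ # 1 ∷ # 2 ∷ # 1 ∷ # 4 ∷ [])

balanced-2 : 2 ≤ m → BalancedGraph m 2
balanced-2 {m = 1} (s≤s ())
balanced-2 {m = 2} _ = seed-2-2
balanced-2 {m = 3} _ = seed-3-2
balanced-2 {m = suc (suc (suc (suc m)))} _ =
  disjointUnionᴮ seed-2-2 (balanced-2 {m = suc (suc m)} (s≤s (s≤s z≤n)))

balanced-3 : 3 ≤ m → BalancedGraph m 3
balanced-3 {m = 1} (s≤s ())
balanced-3 {m = 2} (s≤s (s≤s ()))
balanced-3 {m = 3} _ = seed-3-3
balanced-3 {m = 4} _ = seed-4-3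
balanced-3 {m = 5} _ = seed-5-3
balanced-3 {m = suc (suc (suc (suc (suc (suc m)))))} _ =
  disjointUnionᴮ seed-3-3 (balanced-3 {m = suc (suc (suc m))} (s≤s (s≤s (s≤s z≤n))))

balancedGraph : 3 ≤ m → 2 ≤ k → BalancedGraph m k
balancedGraph {k = 1} _ (s≤s ())
balancedGraph {k = 2} 3≤m _ = balanced-2 (≤-trans (n≤1+n 2) 3≤m)
balancedGraph {k = 3} 3≤m _ = balanced-3 3≤m
balancedGraph {k = suc (suc (suc (suc k)))} 3≤m _ =
  overlayᴮ (balanced-2 (≤-trans (n≤1+n 2) 3≤m)) (balancedGraph 3≤m (s≤s (s≤s z≤n)))

-- From balanced graphs to shiftable signed magic rectangles

toArray : Graph m n → Array m n
toArray G i j = if incident (src G) i j then just +[1+ toℕ j ]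
                else if incident (tgt G) i j then just -[1+ toℕ j ] else nothing

module _ (G : Graph m n) (i : Fin m) (j : Fin n) where

  private
    A : Array m n
    A = toArray G

  filled-toArray : filled (A i j) ≡ incident (src G) i j ∨ incident (tgt G) i j
  filled-toArray with src G j ≟ i | tgt G j ≟ i
  ... | yes _ | _     = refl
  ... | no  _ | yes _ = refl
  ... | no  _ | no  _ = refl

  isPos-toArray : isPos (A i j) ≡ incident (src G) i j
  isPos-toArray with src G j ≟ i | tgt G j ≟ i
  ... | yes _ | _     = refl
  ... | no  _ | yes _ = refl
  ... | no  _ | no  _ = refl

  toArray-inverse : ∀ {x} → A i j ≡ just x →
                    (src G j ≡ i × x ≡ +[1+ toℕ j ]) ⊎ (tgt G j ≡ i × x ≡ -[1+ toℕ j ])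
  toArray-inverse eq with src G j ≟ i | tgt G j ≟ i | eq
  ... | yes s≡i | _       | refl = inj₁ (s≡i , refl)
  ... | no  _   | yes t≡i | refl = inj₂ (t≡i , refl)

  module _ (loopless : Loopless G) where

    isNeg-toArray : isNeg (A i j) ≡ incident (tgt G) i j
    isNeg-toArray with src G j ≟ i | tgt G j ≟ i
    ... | yes s≡i | yes t≡i = ⊥-elim (loopless j (trans s≡i (sym t≡i)))
    ... | yes _   | no  _   = refl
    ... | no  _   | yes _   = refl
    ... | no  _   | no  _   = refl

    val-toArray : val (A i j) ≡ + labelAt (src G) i j - + labelAt (tgt G) i j
    val-toArray with src G j ≟ i | tgt G j ≟ i
    ... | yes s≡i | yes t≡i = ⊥-elim (loopless j (trans s≡i (sym t≡i)))
    ... | yes _   | no  _   = sym (ℤₚ.+-identityʳ _)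
    ... | no  _   | yes _   = refl
    ... | no  _   | no  _   = refl

fromℕ<-unique : ∀ {a} (a<n : a < n) {j : Fin n} → toℕ j ≡ a → j ≡ Fin.fromℕ< a<n
fromℕ<-unique a<n j≡a = Finₚ.toℕ-injective (trans j≡a (sym (Finₚ.toℕ-fromℕ< a<n)))

isVal-sound : ∀ {x c} → isVal x c ≡ true → c ≡ just x
isVal-sound {x} {c} eq with ≡-dec ℤₚ._≟_ c (just x)
... | yes c≡x = c≡x

isVal-complete : ∀ {x c} → c ≡ just x → isVal x c ≡ true
isVal-complete {x} {c} c≡x with ≡-dec ℤₚ._≟_ c (just x)
... | yes _   = refl
... | no  c≢x = ⊥-elim (c≢x c≡x)

module _ (G : Graph m n) (loopless : Loopless G) where

  private
    A : Array m n
    A = toArray G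

  incident-disjoint : (i : Fin m) (j : Fin n) → incident (src G) i j ≡ true → incident (tgt G) i j ≡ false
  incident-disjoint i j with src G j ≟ i
  ... | yes s≡i = λ _ → dec-false (tgt G j ≟ i) (λ t≡i → loopless j (trans s≡i (sym t≡i)))
  ... | no  _   = λ ()

  toArray-src : (j : Fin n) → A (src G j) j ≡ just +[1+ toℕ j ]
  toArray-src j with src G j ≟ src G j
  ... | yes _   = refl
  ... | no  s≢s = ⊥-elim (s≢s refl)

  toArray-tgt : (j : Fin n) → A (tgt G j) j ≡ just -[1+ toℕ j ]
  toArray-tgt j with src G j ≟ tgt G j | tgt G j ≟ tgt G j
  ... | yes s≡t | _       = ⊥-elim (loopless j s≡t)
  ... | no  _   | yes _   = refl
  ... | no  _   | no  t≢t = ⊥-elim (t≢t refl)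

  toArray-entries : ∀ i j {x} → A i j ≡ just x → InX n x
  toArray-entries i j eq with toArray-inverse G i j eq
  ... | inj₁ (_ , refl) = (λ ()) , Finₚ.toℕ<n j
  ... | inj₂ (_ , refl) = (λ ()) , Finₚ.toℕ<n j

  toArray-each-once : ∀ x → InX n x → sumℕ (λ i → count (λ j → isVal x (A i j))) ≡ 1
  toArray-each-once (+ zero)  (x≢0 , _)   = ⊥-elim (x≢0 refl)
  toArray-each-once +[1+ a ] (_ , a<n) = sumℕ-count-unique _ (src G j₀) j₀ only
    (isVal-complete (trans (toArray-src j₀) (cong (just ∘ +[1+_]) (Finₚ.toℕ-fromℕ< a<n))))
    where
    j₀ : Fin n
    j₀ = Fin.fromℕ< a<n
    only : ∀ i j → isVal +[1+ a ] (A i j) ≡ true → i ≡ src G j₀ × j ≡ j₀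
    only i j isv with toArray-inverse G i j (isVal-sound isv)
    ... | inj₁ (s≡i , eq) = trans (sym s≡i) (cong (src G) j≡j₀) , j≡j₀
      where j≡j₀ = fromℕ<-unique a<n (sym (ℤₚ.+[1+-injective eq))
  toArray-each-once -[1+ a ] (_ , a<n) = sumℕ-count-unique _ (tgt G j₀) j₀ only
    (isVal-complete (trans (toArray-tgt j₀) (cong (just ∘ -[1+_]) (Finₚ.toℕ-fromℕ< a<n))))
    where
    j₀ : Fin n
    j₀ = Fin.fromℕ< a<n
    only : ∀ i j → isVal -[1+ a ] (A i j) ≡ true → i ≡ tgt G j₀ × j ≡ j₀
    only i j isv with toArray-inverse G i j (isVal-sound isv)
    ... | inj₂ (t≡i , eq) = trans (sym t≡i) (cong (tgt G) j≡j₀) , j≡j₀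
      where j≡j₀ = fromℕ<-unique a<n (sym (ℤₚ.-[1+-injective eq))

  toArray-col-filled : ∀ j → count (λ i → filled (A i j)) ≡ 2
  toArray-col-filled j = begin
    count (λ i → filled (A i j))
      ≡⟨ count-cong (λ i → filled-toArray G i j) ⟩
    count (λ i → incident (src G) i j ∨ incident (tgt G) i j)
      ≡⟨ count-∨ _ _ (λ i → incident-disjoint i j) ⟩
    count (λ i → does (src G j ≟ i)) + count (λ i → does (tgt G j ≟ i))
      ≡⟨ cong₂ _+_ (count-≟ (src G j)) (count-≟ (tgt G j)) ⟩
    2 ∎
    where open ≡-Reasoning

  toArray-col-sum : ∀ j → sumℤ (λ i → val (A i j)) ≡ + 0
  toArray-col-sum j = begin
    sumℤ (λ i → val (A i j))
      ≡⟨ sumℤ-cong (λ i → val-toArray G i j loopless) ⟩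
    sumℤ (λ i → + labelAt (src G) i j - + labelAt (tgt G) i j)
      ≡⟨ sumℤ-ℕ-difference (λ i → labelAt (src G) i j) (λ i → labelAt (tgt G) i j) ⟩
    + sumWhere (λ i → does (src G j ≟ i)) (λ _ → label j) - + sumWhere (λ i → does (tgt G j ≟ i)) (λ _ → label j)
      ≡⟨ cong₂ (λ a b → + a - + b) (sumWhere-≟ (src G j) _) (sumWhere-≟ (tgt G j) _) ⟩
    + label j - + label j
      ≡⟨ ℤₚ.+-inverseʳ (+ label j) ⟩
    + 0 ∎
    where open ≡-Reasoning

  toArray-col-balanced : ∀ j → count (λ i → isPos (A i j)) ≡ count (λ i → isNeg (A i j))
  toArray-col-balanced j = begin
    count (λ i → isPos (A i j))       ≡⟨ count-cong (λ i → isPos-toArray G i j) ⟩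
    count (λ i → does (src G j ≟ i))  ≡⟨ trans (count-≟ (src G j)) (sym (count-≟ (tgt G j))) ⟩
    count (λ i → does (tgt G j ≟ i))  ≡⟨ count-cong (λ i → isNeg-toArray G i j loopless) ⟨
    count (λ i → isNeg (A i j))       ∎
    where open ≡-Reasoning

  module _ (balanced : IsBalanced k G) where

    toArray-row-filled : ∀ i → count (λ j → filled (A i j)) ≡ 2 * k
    toArray-row-filled i with balanced i
    ... | out , in′ , _ = begin
      count (λ j → filled (A i j))                               ≡⟨ count-cong (filled-toArray G i) ⟩
      count (λ j → incident (src G) i j ∨ incident (tgt G) i j)  ≡⟨ count-∨ _ _ (incident-disjoint i) ⟩
      degree (src G) i + degree (tgt G) i                        ≡⟨ cong₂ _+_ out in′ ⟩
      k + k                                                      ≡⟨ cong (_+_ k) (+-identityʳ k) ⟨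
      2 * k                                                      ∎
      where open ≡-Reasoning

    toArray-row-sum : ∀ i → sumℤ (λ j → val (A i j)) ≡ + 0
    toArray-row-sum i with balanced i
    ... | _ , _ , w = begin
      sumℤ (λ j → val (A i j))
        ≡⟨ sumℤ-cong (λ j → val-toArray G i j loopless) ⟩
      sumℤ (λ j → + labelAt (src G) i j - + labelAt (tgt G) i j)
        ≡⟨ sumℤ-ℕ-difference (labelAt (src G) i) (labelAt (tgt G) i) ⟩
      + weight (src G) i - + weight (tgt G) i
        ≡⟨ cong (λ w′ → + w′ - + weight (tgt G) i) w ⟩
      + weight (tgt G) i - + weight (tgt G) i
        ≡⟨ ℤₚ.+-inverseʳ (+ weight (tgt G) i) ⟩
      + 0 ∎
      where open ≡-Reasoning

    toArray-row-balanced : ∀ i → count (λ j → isPos (A i j)) ≡ count (λ j → isNeg (A i j))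
    toArray-row-balanced i with balanced i
    ... | out , in′ , _ = begin
      count (λ j → isPos (A i j))  ≡⟨ count-cong (isPos-toArray G i) ⟩
      degree (src G) i             ≡⟨ trans out (sym in′) ⟩
      degree (tgt G) i             ≡⟨ count-cong (λ j → isNeg-toArray G i j loopless) ⟨
      count (λ j → isNeg (A i j))  ∎
      where open ≡-Reasoning

balancedGraph⇒SMR : BalancedGraph m k → m * (2 * k) ≡ 2 * n →
                    Σ (Array m n) (λ A → IsSMR m n (2 * k) 2 A × Shiftable A)
balancedGraph⇒SMR {m = m} {k = k} {n = n} B m[2k]≡2n with size≡n
  where
  open BalancedGraph B
  size≡n : size ≡ n
  size≡n = *-cancelˡ-≡ size n 2 (begin
    2 * size     ≡⟨ cong (2 *_) size≡ ⟩
    2 * (m * k)  ≡⟨ *-assoc 2 m k ⟨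
    2 * m * k    ≡⟨ cong (_* k) (*-comm 2 m) ⟩
    m * 2 * k    ≡⟨ *-assoc m 2 k ⟩
    m * (2 * k)  ≡⟨ m[2k]≡2n ⟩
    2 * n        ∎)
    where open ≡-Reasoning
... | refl = toArray graph , isSMR , shiftable
  where
  open BalancedGraph B
  size-eq : m * (2 * k) ≡ size * 2
  size-eq = trans m[2k]≡2n (*-comm 2 size)
  half : (m * (2 * k)) / 2 ≡ size
  half = trans (cong (_/ 2) size-eq) (m*n/n≡m size 2)
  isSMR : IsSMR m size (2 * k) 2 (toArray graph)
  isSMR = record
    { size-eq      = size-eq
    ; row-filled   = toArray-row-filled graph loopless balanced
    ; col-filled   = toArray-col-filled graph loopless
    ; entries-in-X = λ i j x eq → subst (λ h → InX h x) (sym half) (toArray-entries graph loopless i j eq)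
    ; each-once    = λ x x∈X → toArray-each-once graph loopless x (subst (λ h → InX h x) half x∈X)
    ; row-sum      = toArray-row-sum graph loopless balanced
    ; col-sum      = toArray-col-sum graph loopless
    }
  shiftable : Shiftable (toArray graph)
  shiftable = record
    { row-bal = toArray-row-balanced graph loopless balanced
    ; col-bal = toArray-col-balanced graph loopless
    }

-- Lines with two filled cells

filled≡isPos∨isNeg : (c : Maybe ℤ) → c ≢ just (+ 0) → filled c ≡ isPos c ∨ isNeg c
filled≡isPos∨isNeg nothing          _   = refl
filled≡isPos∨isNeg (just (+ zero))  c≢0 = ⊥-elim (c≢0 refl)
filled≡isPos∨isNeg (just +[1+ _ ])  _   = refl
filled≡isPos∨isNeg (just -[1+ _ ])  _   = refl

isPos⇒¬isNeg : (c : Maybe ℤ) → isPos c ≡ true → isNeg c ≡ false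
isPos⇒¬isNeg (just +[1+ _ ]) _ = refl

isPos-inverse : (c : Maybe ℤ) → isPos c ≡ true → ∃ λ t → c ≡ just +[1+ t ]
isPos-inverse (just +[1+ t ]) _ = t , refl

isNeg-inverse : (c : Maybe ℤ) → isNeg c ≡ true → ∃ λ t → c ≡ just -[1+ t ]
isNeg-inverse (just -[1+ t ]) _ = t , refl

val-neither : (c : Maybe ℤ) → isPos c ≡ false → isNeg c ≡ false → val c ≡ + 0
val-neither nothing         _ _ = refl
val-neither (just (+ zero)) _ _ = refl

x+x≡2⇒x≡1 : ∀ x → x + x ≡ 2 → x ≡ 1
x+x≡2⇒x≡1 1             _  = refl
x+x≡2⇒x≡1 (suc (suc x)) eq = case trans (sym (+-suc x (suc x))) (suc-injective (suc-injective eq)) of λ ()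

record TwoCellLine (g : Fin k → Maybe ℤ) : Set where
  field
    pos neg    : Fin k
    t          : ℕ
    pos≢neg    : pos ≢ neg
    g-pos      : g pos ≡ just +[1+ t ]
    g-neg      : g neg ≡ just -[1+ t ]
    pos-unique : ∀ j → isPos (g j) ≡ true → j ≡ pos

module _ (g : Fin k → Maybe ℤ) (g≢0 : ∀ j → g j ≢ just (+ 0)) (filled≡2 : count (filled ∘ g) ≡ 2)
         (balanced : count (isPos ∘ g) ≡ count (isNeg ∘ g)) where

  one-positive : count (isPos ∘ g) ≡ 1
  one-positive = x+x≡2⇒x≡1 _ (begin
    count (isPos ∘ g) + count (isPos ∘ g)    ≡⟨ cong (_+_ (count (isPos ∘ g))) balanced ⟩
    count (isPos ∘ g) + count (isNeg ∘ g)    ≡⟨ count-∨ (isPos ∘ g) (isNeg ∘ g) (isPos⇒¬isNeg ∘ g) ⟨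
    count (λ j → isPos (g j) ∨ isNeg (g j))  ≡⟨ count-cong (λ j → filled≡isPos∨isNeg (g j) (g≢0 j)) ⟨
    count (filled ∘ g)                       ≡⟨ filled≡2 ⟩
    2                                        ∎)
    where open ≡-Reasoning

  one-negative : count (isNeg ∘ g) ≡ 1
  one-negative = trans (sym balanced) one-positive

  twoCellLine : sumℤ (val ∘ g) ≡ + 0 → TwoCellLine g
  twoCellLine sum≡0
    with count≡1⇒unique (isPos ∘ g) one-positive | count≡1⇒unique (isNeg ∘ g) one-negative
  ... | pos , isPos-pos , pos-unique | neg , isNeg-neg , neg-unique
    with isPos-inverse (g pos) isPos-pos | isNeg-inverse (g neg) isNeg-neg
  ... | t , g-pos | t′ , g-neg = record
    { pos = pos ; neg = neg ; t = t ; pos≢neg = pos≢neg ; g-pos = g-pos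
    ; g-neg = trans g-neg (cong (just ∘ -[1+_]) (sym t≡t′)) ; pos-unique = pos-unique }
    where
    pos≢neg : pos ≢ neg
    pos≢neg refl = case trans (sym (isPos⇒¬isNeg (g pos) isPos-pos)) isNeg-neg of λ ()
    pair-sum : val (g pos) +ℤ val (g neg) ≡ + 0
    pair-sum = trans (sym (sumℤ-pair (val ∘ g) pos≢neg λ j j≢pos j≢neg →
                 val-neither (g j) (¬-not (j≢pos ∘ pos-unique j)) (¬-not (j≢neg ∘ neg-unique j)))) sum≡0
    t≡t′ : t ≡ t′
    t≡t′ = ℤₚ.+[1+-injective (ℤₚ.i-j≡0⇒i≡j +[1+ t ] +[1+ t′ ]
             (trans (sym (cong₂ (λ a b → val a +ℤ val b) g-pos g-neg)) pair-sum))

-- The −t beside the +t of some row reappears in the column through that +t.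
no-shiftable-SMR-r≡2 : (A : Array m n) → IsSMR m n 2 2 A → Shiftable A → ¬ Fin m
no-shiftable-SMR-r≡2 {m = m} A smr shiftable i₀ = <-irrefl refl twice≤once
  where
  open IsSMR smr
  open Shiftable shiftable
  nonzero : ∀ i j → A i j ≢ just (+ 0)
  nonzero i j eq = proj₁ (entries-in-X i j (+ 0) eq) refl
  row : TwoCellLine (A i₀)
  row = twoCellLine (A i₀) (nonzero i₀) (row-filled i₀) (row-bal i₀) (row-sum i₀)
  module R = TwoCellLine row
  col : TwoCellLine (λ i → A i R.pos)
  col = twoCellLine (λ i → A i R.pos) (λ i → nonzero i R.pos) (col-filled R.pos) (col-bal R.pos) (col-sum R.pos)
  module C = TwoCellLine col
  i₀≡C-pos : i₀ ≡ C.pos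
  i₀≡C-pos = C.pos-unique i₀ (cong isPos R.g-pos)
  i₀≢C-neg : i₀ ≢ C.neg
  i₀≢C-neg = C.pos≢neg ∘ trans (sym i₀≡C-pos)
  R-t≡C-t : R.t ≡ C.t
  R-t≡C-t = ℤₚ.+[1+-injective (just-injective (trans (sym R.g-pos) (trans (cong (λ i → A i R.pos) i₀≡C-pos) C.g-pos)))
  x : ℤ
  x = -[1+ R.t ]
  occurrences : Fin m → ℕ
  occurrences i = count (λ j → isVal x (A i j))
  twice≤once : 2 ≤ 1
  twice≤once = begin
    1 + 1
      ≤⟨ +-mono-≤ (count-≥1 (λ j → isVal x (A i₀ j)) (isVal-complete R.g-neg))
                  (count-≥1 (λ j → isVal x (A C.neg j))
                            (isVal-complete (trans C.g-neg (cong (just ∘ -[1+_]) (sym R-t≡C-t))))) ⟩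
    occurrences i₀ + occurrences C.neg
      ≤⟨ sumℕ-≥-pair occurrences i₀≢C-neg ⟩
    sumℕ occurrences
      ≡⟨ each-once x (entries-in-X i₀ R.neg x R.g-neg) ⟩
    1 ∎
    where open ≤-Reasoning

column-size-≤-rows : ∀ {r s} {A : Array m n} → IsSMR m n r s A → Fin n → s ≤ m
column-size-≤-rows {A = A} smr j = subst (_≤ _) (IsSMR.col-filled smr j) (count-≤ (λ i → filled (A i j)))

odd-≥2⇒≥3 : ∀ a → 2 ≤ 2 * a + 1 → 3 ≤ 2 * a + 1
odd-≥2⇒≥3 zero    (s≤s ())
odd-≥2⇒≥3 (suc a) _ = +-monoˡ-≤ 1 (*-monoʳ-≤ 2 (s≤s (z≤n {a})))

shiftable-SMR-r≥4 : ∀ b {A : Array m n} → IsSMR m n (2 * b) 2 A → Shiftable A → 0 < 2 * b → Fin m → 4 ≤ 2 * b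
shiftable-SMR-r≥4 1             smr shiftable _ i = ⊥-elim (no-shiftable-SMR-r≡2 _ smr shiftable i)
shiftable-SMR-r≥4 (suc (suc b)) _   _         _ _ = *-monoʳ-≤ 2 (s≤s (s≤s (z≤n {b})))

theorem28 : (m n r : ℕ) → (∃ λ k → m ≡ 2 * k + 1) → (∃ λ k → r ≡ 2 * k) → 0 < r → 0 < n →
    (Σ (Array m n) (λ A → IsSMR m n r 2 A × Shiftable A))
      ⇔ (3 ≤ m × 4 ≤ r × m * r ≡ 2 * n)
theorem28 m n r (a , refl) (b , refl) 0<r 0<n = mk⇔ necessary sufficient
  where
  necessary : Σ (Array m n) (λ A → IsSMR m n r 2 A × Shiftable A) → 3 ≤ m × 4 ≤ r × m * r ≡ 2 * n
  necessary (A , smr , shiftable) =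
    odd-≥2⇒≥3 a (column-size-≤-rows smr (Fin.fromℕ< 0<n)) ,
    shiftable-SMR-r≥4 b smr shiftable 0<r (Fin.fromℕ< (m≤n+m 1 (2 * a))) ,
    trans (IsSMR.size-eq smr) (*-comm n 2)

  sufficient : 3 ≤ m × 4 ≤ r × m * r ≡ 2 * n → Σ (Array m n) (λ A → IsSMR m n r 2 A × Shiftable A)
  sufficient (3≤m , 4≤r , mr≡2n) = balancedGraph⇒SMR (balancedGraph 3≤m (*-cancelˡ-≤ {2} {b} 2 4≤r)) mr≡2n
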